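{- Let $i\ge 2$ and let $c_0,\dots,c_{i-1}$ be the vertices of a cycle in cyclic order, with positive integer weights $w(c_0),\dots,w(c_{i-1})$ and total weight $W=\sum_j w(c_j)$. Consider the following procedure: initialize $b_{OPT}\gets 0$, a FIFO queue $Q_1$ empty and a FIFO queue $Q_2=(c_0,c_1,\dots,c_{i-1})$ (head $c_0$). Repeat the following loop body until $c_0$ becomes the head of $Q_1$ for the second time (i.e. $c_0$ has been head of $Q_1$, has been removed from $Q_1$, and is again head of $Q_1$): update $b_{OPT}\gets\max\{b_{OPT},\min\{w(Q_1),w(Q_2)\}\}$; then if $w(Q_1)>w(Q_2)$, dequeue the head of $Q_1$ and append it to the tail of $Q_2$, otherwise dequeue the head of $Q_2$ and append it to the tail of $Q_1$. Here $w(Q)$ is the sum of weights of the elements currently in $Q$. Then the returned value $b_{OPT}$ equals the maximum, over all cuts represented by the cycle, of the balance of the cut; that is, $b_{OPT}=\max_S \min\{w(S),W-w(S)\}$, where $S$ ranges over all non-empty proper subsets of $\{c_0,\dots,c_{i-1}\}$ consisting of cyclically consecutive vertices $c_j,c_{j+1 \bmod i},\dots,c_{k\bmod i}$, and $w(S)=\sum_{c\in S}w(c)$. (Thus the procedure finds a most balanced minimum cut among those represented by the cycle, the cut corresponding to the pair $(Q_1,Q_2)$ at which the maximum was attained.)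
   Context: This arises for a cycle of a cactus representation of all minimum cuts: the weight $w(c_j)$ is the number of original graph vertices in the sub-cactus hanging at $c_j$, a minimum cut represented by the cycle removes two cycle edges and thus splits the cycle into two arcs of consecutive cycle vertices, and the balance of such a cut is the weight of its lighter side. A queue supports appending an element at its tail and removing the element at its head. -}

module Defs where

open import Data.Nat using (ℕ; zero; suc; _+_; _∸_; _⊔_; _⊓_; _<ᵇ_; _≡ᵇ_)
open import Data.Bool using (Bool; true; false; if_then_else_; _∨_; _∧_)
open import Data.Fin using (Fin; toℕ)
open import Data.List using (List; []; _∷_; _++_; [_]; map; take; drop; allFin)
open import Data.Nat.ListAction using (sum)
open import Data.Maybe using (Maybe; just; nothing)

-- Cycle vertices c_0,…,c_{i-1} are represented by Fin i; weights by w : Fin i → ℕ.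

-- w(Q): total weight of the elements of a queue (a list; head = first element).
wQ : ∀ {i} → (Fin i → ℕ) → List (Fin i) → ℕ
wQ w q = sum (map w q)

totalW : ∀ {i} → (Fin i → ℕ) → ℕ
totalW {i} w = wQ w (allFin i)

-- The arc of ℓ cyclically consecutive vertices starting at c_j:
-- c_j, c_{j+1 mod i}, …, c_{j+ℓ-1 mod i}   (for ℓ ≤ i).
arc : (i : ℕ) → Fin i → ℕ → List (Fin i)
arc i j ℓ = take ℓ (drop (toℕ j) (allFin i ++ allFin i))

balance : ∀ {i} → (Fin i → ℕ) → Fin i → ℕ → ℕ
balance {i} w j ℓ = wQ w (arc i j ℓ) ⊓ (totalW w ∸ wQ w (arc i j ℓ))

-- State of the procedure: Q1, Q2, b_OPT, and a flag recording whether c_0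
-- has already been removed from Q1.
record State (i : ℕ) : Set where
  constructor st
  field
    q1      : List (Fin i)
    q2      : List (Fin i)
    bopt    : ℕ
    removed : Bool
open State public

isC0 : ∀ {i} → Fin i → Bool
isC0 x = toℕ x ≡ᵇ 0

stop : ∀ {i} → State i → Bool
stop (st [] _ _ r) = false
stop (st (x ∷ _) _ _ r) = r ∧ isC0 x

step : ∀ {i} → (Fin i → ℕ) → State i → State i
step w (st q₁ q₂ b r) =
  let b' = b ⊔ (wQ w q₁ ⊓ wQ w q₂) in
  if wQ w q₂ <ᵇ wQ w q₁
  then moveFrom1 q₁ q₂ b' r
  else moveFrom2 q₁ q₂ b' r
  where
  moveFrom1 : ∀ {i} → List (Fin i) → List (Fin i) → ℕ → Bool → State i
  moveFrom1 [] q₂ b r = st [] q₂ b r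
  moveFrom1 (x ∷ q₁) q₂ b r = st q₁ (q₂ ++ [ x ]) b (r ∨ isC0 x)
  moveFrom2 : ∀ {i} → List (Fin i) → List (Fin i) → ℕ → Bool → State i
  moveFrom2 q₁ [] b r = st q₁ [] b r
  moveFrom2 q₁ (x ∷ q₂) b r = st (q₁ ++ [ x ]) q₂ b r

init : (i : ℕ) → State i
init i = st [] (allFin i) 0 false

-- Run the loop with a fuel bound: returns just b_OPT if the loop terminates
-- within the given number of termination tests, nothing otherwise.
run : ∀ {i} → (Fin i → ℕ) → ℕ → State i → Maybe ℕ
run w zero s = nothing
run w (suc f) s = if stop s then just (bopt s) else run w f (step w s)

-- Index the cycle by ℕ, reading c_x as c_(x mod n). After a dequeues from Q₁ the queue Q₁ is the
-- arc of l vertices starting at c_a and Q₂ is the complementary arc, and every loop iteration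
-- increases 2a + l by one, so the scan ends once a = n. Call an arc light if it weighs at most
-- W/2; the balance of a cut is the weight of its light side. The scan keeps the invariant: a light
-- arc starting before c_a ends within Q₁, and a light arc ending within Q₁ weighs at most b_OPT
-- unless it is a suffix of Q₁. Q₁ is extended only when it is light, and b_OPT ≥ w(Q₁) then bounds
-- all its suffixes; the head of Q₁ is dropped only when Q₁ is heavy, and then no light arc
-- contains Q₁. At a = n every light arc is bounded by b_OPT, which is itself the balance of one of
-- the cuts inspected along the way.
module Submission where

open import Defs
open import Data.Bool using (Bool; true; false; _∨_; _∧_)
open import Data.Bool.Properties using (T-≡; ¬-not)
open import Data.Empty using (⊥; ⊥-elim)
open import Data.Fin using (Fin; toℕ)
open import Data.Fin.Properties using (toℕ-fromℕ<; fromℕ<-cong; toℕ-injective; toℕ<n)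
open import Data.List using (List; []; _∷_; _++_; [_]; map; take; drop; allFin; tabulate)
open import Data.List.Properties using (map-++; tabulate-cong)
open import Data.Maybe using (just)
open import Data.Nat using (ℕ; zero; suc; _+_; _∸_; _⊔_; _⊓_; _<ᵇ_; _≡ᵇ_; _%_; _≤_; _<_;
  z≤n; s≤s; s≤s⁻¹; z<s; NonZero; >-nonZero; >-nonZero⁻¹)
open import Data.Nat.DivMod using (_mod_; m%n<n; m%n%n≡m%n; [m+n]%n≡m%n; %-distribˡ-+; m<n⇒m%n≡m; n%n≡0)
open import Data.Nat.ListAction using (sum)
open import Data.Nat.ListAction.Properties using (sum-++)
open import Data.Nat.Properties
open import Data.Product using (Σ; _×_; _,_; ∃-syntax)
open import Data.Sum using (_⊎_; inj₁; inj₂)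
open import Function.Bundles using (Equivalence)
open import Relation.Nullary using (¬_; yes; no)
open import Relation.Binary.PropositionalEquality using (_≡_; refl; sym; trans; cong; cong₂; subst; subst₂; module ≡-Reasoning)

module Segments (n : ℕ) .{{_ : NonZero n}} (w : Fin n → ℕ) where

  vertex : ℕ → Fin n
  vertex x = x mod n

  toℕ-vertex : ∀ x → toℕ (vertex x) ≡ x % n
  toℕ-vertex x = toℕ-fromℕ< (m%n<n x n)

  toℕ-vertex-< : ∀ {x} → x < n → toℕ (vertex x) ≡ x
  toℕ-vertex-< {x} x<n = trans (toℕ-vertex x) (m<n⇒m%n≡m x<n)

  vertex-toℕ : ∀ j → vertex (toℕ j) ≡ j
  vertex-toℕ j = toℕ-injective (toℕ-vertex-< (toℕ<n j))

  vertex-cong-% : ∀ {x y} → x % n ≡ y % n → vertex x ≡ vertex y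
  vertex-cong-% {x} {y} eq = fromℕ<-cong (x % n) (y % n) eq (m%n<n x n) (m%n<n y n)

  vertex-+n : ∀ x → vertex (x + n) ≡ vertex x
  vertex-+n x = vertex-cong-% ([m+n]%n≡m%n x n)

  suc-cong-% : ∀ {x y} → x % n ≡ y % n → suc x % n ≡ suc y % n
  suc-cong-% {x} {y} eq = begin
    (1 + x) % n             ≡⟨ %-distribˡ-+ 1 x n ⟩
    (1 % n + x % n) % n     ≡⟨ cong (λ r → (1 % n + r) % n) eq ⟩
    (1 % n + y % n) % n     ≡⟨ %-distribˡ-+ 1 y n ⟨
    (1 + y) % n             ∎
    where open ≡-Reasoning

  segment : ℕ → ℕ → List (Fin n)
  segment x zero    = []
  segment x (suc m) = vertex x ∷ segment (suc x) m

  segment-++ : ∀ x m p → segment x (m + p) ≡ segment x m ++ segment (x + m) p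
  segment-++ x zero    p = cong (λ y → segment y p) (sym (+-identityʳ x))
  segment-++ x (suc m) p = cong (vertex x ∷_) (trans (segment-++ (suc x) m p)
                                                     (cong (λ y → segment (suc x) m ++ segment y p) (sym (+-suc x m))))

  segment-snoc : ∀ x m → segment x (suc m) ≡ segment x m ++ [ vertex (x + m) ]
  segment-snoc x m = trans (cong (segment x) (+-comm 1 m)) (segment-++ x m 1)

  segment-cong-% : ∀ {x y} m → x % n ≡ y % n → segment x m ≡ segment y m
  segment-cong-% zero    eq = refl
  segment-cong-% (suc m) eq = cong₂ _∷_ (vertex-cong-% eq) (segment-cong-% m (suc-cong-% eq))

  segment-% : ∀ x m → segment (x % n) m ≡ segment x m
  segment-% x m = segment-cong-% m (m%n%n≡m%n x n)

  segment-+n : ∀ x m → segment (x + n) m ≡ segment x m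
  segment-+n x m = segment-cong-% m ([m+n]%n≡m%n x n)

  segment-tabulate : ∀ x m → segment x m ≡ tabulate {n = m} (λ t → vertex (x + toℕ t))
  segment-tabulate x zero    = refl
  segment-tabulate x (suc m) = cong₂ _∷_ (cong vertex (sym (+-identityʳ x)))
    (trans (segment-tabulate (suc x) m) (tabulate-cong (λ t → cong vertex (sym (+-suc x (toℕ t))))))

  allFin≡segment : allFin n ≡ segment 0 n
  allFin≡segment = sym (trans (segment-tabulate 0 n) (tabulate-cong vertex-toℕ))

  drop-segment : ∀ d x m → drop d (segment x m) ≡ segment (x + d) (m ∸ d)
  drop-segment zero    x m       = cong (λ y → segment y m) (sym (+-identityʳ x))
  drop-segment (suc d) x zero    = refl
  drop-segment (suc d) x (suc m) = trans (drop-segment d (suc x) m) (cong (λ y → segment y (m ∸ d)) (sym (+-suc x d)))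

  take-segment : ∀ {l m} x → l ≤ m → take l (segment x m) ≡ segment x l
  take-segment x z≤n       = refl
  take-segment x (s≤s l≤m) = cong (vertex x ∷_) (take-segment (suc x) l≤m)

  arc≡segment : ∀ j {l} → l ≤ n → arc n j l ≡ segment (toℕ j) l
  arc≡segment j {l} l≤n = begin
    take l (drop (toℕ j) (allFin n ++ allFin n))       ≡⟨ cong (λ q → take l (drop (toℕ j) (q ++ q))) allFin≡segment ⟩
    take l (drop (toℕ j) (segment 0 n ++ segment 0 n)) ≡⟨ cong (λ q → take l (drop (toℕ j) (segment 0 n ++ q))) (sym (segment-+n 0 n)) ⟩
    take l (drop (toℕ j) (segment 0 n ++ segment n n)) ≡⟨ cong (λ q → take l (drop (toℕ j) q)) (sym (segment-++ 0 n n)) ⟩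
    take l (drop (toℕ j) (segment 0 (n + n)))          ≡⟨ cong (take l) (drop-segment (toℕ j) 0 (n + n)) ⟩
    take l (segment (toℕ j) (n + n ∸ toℕ j))           ≡⟨ take-segment (toℕ j) (≤-trans l≤n n≤room) ⟩
    segment (toℕ j) l                                  ∎
    where
    open ≡-Reasoning
    n≤room : n ≤ n + n ∸ toℕ j
    n≤room = ≤-trans (m≤m+n n (n ∸ toℕ j)) (≤-reflexive (sym (+-∸-assoc n (<⇒≤ (toℕ<n j)))))

  W : ℕ
  W = totalW w

  segW : ℕ → ℕ → ℕ
  segW x m = wQ w (segment x m)

  wQ-++ : ∀ xs ys → wQ w (xs ++ ys) ≡ wQ w xs + wQ w ys
  wQ-++ xs ys = trans (cong sum (map-++ w xs ys)) (sum-++ (map w xs) (map w ys))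

  segW-++ : ∀ x m p → segW x (m + p) ≡ segW x m + segW (x + m) p
  segW-++ x m p = trans (cong (wQ w) (segment-++ x m p)) (wQ-++ (segment x m) (segment (x + m) p))

  segW-% : ∀ x m → segW (x % n) m ≡ segW x m
  segW-% x m = cong (wQ w) (segment-% x m)

  -- Both sides equal segW x (n + 1), since c_(x+n) = c_x.
  segW-rotate : ∀ x → segW (suc x) n ≡ segW x n
  segW-rotate x = +-cancelˡ-≡ (w (vertex x)) _ _ (begin
    w (vertex x) + segW (suc x) n        ≡⟨ cong (segW x) (+-comm 1 n) ⟩
    segW x (n + 1)                       ≡⟨ segW-++ x n 1 ⟩
    segW x n + (w (vertex (x + n)) + 0)  ≡⟨ cong (λ v → segW x n + (w v + 0)) (vertex-+n x) ⟩
    segW x n + (w (vertex x) + 0)        ≡⟨ cong (segW x n +_) (+-identityʳ _) ⟩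
    segW x n + w (vertex x)              ≡⟨ +-comm (segW x n) _ ⟩
    w (vertex x) + segW x n              ∎)
    where open ≡-Reasoning

  segW-full : ∀ x → segW x n ≡ W
  segW-full zero    = sym (cong (wQ w) allFin≡segment)
  segW-full (suc x) = trans (segW-rotate x) (segW-full x)

  segW-complement : ∀ x {l} → l ≤ n → segW x l + segW (x + l) (n ∸ l) ≡ W
  segW-complement x {l} l≤n = trans (sym (segW-++ x l (n ∸ l))) (trans (cong (segW x) (m+[n∸m]≡n l≤n)) (segW-full x))

  segW-prefix : ∀ x m r → segW x m ≤ segW x (m + r)
  segW-prefix x m r = ≤-trans (m≤m+n _ _) (≤-reflexive (sym (segW-++ x m r)))

  segW-suffix : ∀ x d m → segW (x + d) m ≤ segW x (d + m)
  segW-suffix x d m = ≤-trans (m≤n+m _ _) (≤-reflexive (sym (segW-++ x d m)))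

  segW-mono : ∀ {a j m l} → a ≤ j → j + m ≤ a + l → segW j m ≤ segW a l
  segW-mono {a} {j} {m} {l} a≤j end≤ with m≤n⇒∃[o]m+o≡n a≤j | m≤n⇒∃[o]m+o≡n end≤
  ... | d , refl | r , eq = begin
    segW (a + d) m          ≤⟨ segW-prefix (a + d) m r ⟩
    segW (a + d) (m + r)    ≤⟨ segW-suffix a d (m + r) ⟩
    segW a (d + (m + r))    ≡⟨ cong (segW a) length-eq ⟩
    segW a l                ∎
    where
    open ≤-Reasoning
    length-eq : d + (m + r) ≡ l
    length-eq = +-cancelˡ-≡ a _ _ (trans (sym (+-assoc a d (m + r))) (trans (sym (+-assoc (a + d) m r)) eq))

  cutBalance : ℕ → ℕ → ℕ
  cutBalance x l = segW x l ⊓ segW (x + l) (n ∸ l)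

  balance-vertex : ∀ x {l} → l ≤ n → balance w (vertex x) l ≡ cutBalance x l
  balance-vertex x {l} l≤n = begin
    wQ w (arc n (vertex x) l) ⊓ (W ∸ wQ w (arc n (vertex x) l)) ≡⟨ cong (λ s → s ⊓ (W ∸ s)) arc-weight ⟩
    segW x l ⊓ (W ∸ segW x l)                                   ≡⟨ cong (segW x l ⊓_) co-weight ⟩
    segW x l ⊓ segW (x + l) (n ∸ l)                             ∎
    where
    open ≡-Reasoning
    arc-weight : wQ w (arc n (vertex x) l) ≡ segW x l
    arc-weight = trans (cong (wQ w) (arc≡segment (vertex x) l≤n))
                       (trans (cong (λ y → segW y l) (toℕ-vertex x)) (segW-% x l))
    co-weight : W ∸ segW x l ≡ segW (x + l) (n ∸ l)
    co-weight = trans (cong (_∸ segW x l) (sym (segW-complement x l≤n))) (m+n∸m≡n (segW x l) _)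

  balance-toℕ : ∀ j {l} → l ≤ n → balance w j l ≡ cutBalance (toℕ j) l
  balance-toℕ j {l} l≤n = trans (cong (λ v → balance w v l) (sym (vertex-toℕ j))) (balance-vertex (toℕ j) l≤n)

module Scan (n : ℕ) .{{_ : NonZero n}} (w : Fin n → ℕ) (w-pos : ∀ j → 0 < w j) where
  open Segments n w

  c₀-dequeued : ℕ → Bool
  c₀-dequeued zero    = false
  c₀-dequeued (suc _) = true

  -- The state after a dequeues from Q₁, when Q₁ holds l vertices; c₀ is the first vertex ever
  -- dequeued from Q₁.
  state : ℕ → ℕ → ℕ → State n
  state a l b = st (segment a l) (segment (a + l) (n ∸ l)) b (c₀-dequeued a)

  init≡state : init n ≡ state 0 0 0
  init≡state = cong (λ q → st [] q 0 false) allFin≡segment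

  step-from-Q₁ : ∀ {x q₁ q₂ b r} → wQ w q₂ < wQ w (x ∷ q₁) →
    step w (st (x ∷ q₁) q₂ b r) ≡ st q₁ (q₂ ++ [ x ]) (b ⊔ (wQ w (x ∷ q₁) ⊓ wQ w q₂)) (r ∨ isC0 x)
  step-from-Q₁ Q₂<Q₁ rewrite Equivalence.to T-≡ (<⇒<ᵇ Q₂<Q₁) = refl

  step-from-Q₂ : ∀ {y q₁ q₂ q₂′ b r} → q₂ ≡ y ∷ q₂′ → ¬ (wQ w q₂ < wQ w q₁) →
    step w (st q₁ q₂ b r) ≡ st (q₁ ++ [ y ]) q₂′ (b ⊔ (wQ w q₁ ⊓ wQ w q₂)) r
  step-from-Q₂ {q₁ = q₁} {q₂} refl Q₂≮Q₁ rewrite ¬-not {wQ w q₂ <ᵇ wQ w q₁} {true}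
    (λ lt → Q₂≮Q₁ (<ᵇ⇒< _ _ (Equivalence.from T-≡ lt))) = refl

  c₀-dequeued-step : ∀ a → c₀-dequeued a ∨ isC0 (vertex a) ≡ true
  c₀-dequeued-step zero    = cong (_≡ᵇ 0) (toℕ-vertex-< (>-nonZero⁻¹ n))
  c₀-dequeued-step (suc a) = refl

  move₁ : ∀ {a l b} → suc l ≤ n → segW (a + suc l) (n ∸ suc l) < segW a (suc l) →
    step w (state a (suc l) b) ≡ state (suc a) l (b ⊔ cutBalance a (suc l))
  move₁ {a} {l} {b} l<n Q₂<Q₁ = trans (step-from-Q₁ Q₂<Q₁)
    (cong₂ (λ q₂ r → st (segment (suc a) l) q₂ (b ⊔ cutBalance a (suc l)) r) Q₂-grows (c₀-dequeued-step a))
    where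
    open ≡-Reasoning
    ends-at-a : a + suc l + (n ∸ suc l) ≡ a + n
    ends-at-a = trans (+-assoc a (suc l) _) (cong (a +_) (m+[n∸m]≡n l<n))
    Q₂-grows : segment (a + suc l) (n ∸ suc l) ++ [ vertex a ] ≡ segment (suc a + l) (n ∸ l)
    Q₂-grows = begin
      segment (a + suc l) (n ∸ suc l) ++ [ vertex a ]
        ≡⟨ cong (λ v → segment (a + suc l) (n ∸ suc l) ++ [ v ]) (trans (sym (vertex-+n a)) (cong vertex (sym ends-at-a))) ⟩
      segment (a + suc l) (n ∸ suc l) ++ [ vertex (a + suc l + (n ∸ suc l)) ]
        ≡⟨ segment-snoc (a + suc l) (n ∸ suc l) ⟨
      segment (a + suc l) (suc (n ∸ suc l))
        ≡⟨ cong₂ segment (+-suc a l) (sym (+-∸-assoc 1 l<n)) ⟩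
      segment (suc a + l) (n ∸ l) ∎

  move₂ : ∀ {a l b} → l < n → ¬ (segW (a + l) (n ∸ l) < segW a l) →
    step w (state a l b) ≡ state a (suc l) (b ⊔ cutBalance a l)
  move₂ {a} {l} {b} l<n Q₂≮Q₁ = trans (step-from-Q₂ Q₂-uncons Q₂≮Q₁)
    (cong (λ q₁ → st q₁ (segment (a + suc l) (n ∸ suc l)) (b ⊔ cutBalance a l) (c₀-dequeued a)) (sym (segment-snoc a l)))
    where
    Q₂-uncons : segment (a + l) (n ∸ l) ≡ vertex (a + l) ∷ segment (a + suc l) (n ∸ suc l)
    Q₂-uncons = trans (cong (segment (a + l)) (+-∸-assoc 1 l<n))
                      (cong (λ y → vertex (a + l) ∷ segment y (n ∸ suc l)) (sym (+-suc a l)))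

  Light : ℕ → ℕ → Set
  Light j m = segW j m + segW j m ≤ W

  light-⊆ : ∀ {j m a l} → Light j m → j ≤ a → a + l ≤ j + m → Light a l
  light-⊆ {j} {m} {a} {l} light j≤a end≤ = ≤-trans (+-mono-≤ inner inner) light
    where
    inner : segW a l ≤ segW j m
    inner = segW-mono j≤a end≤

  heavy-Q₁ : ∀ {a l} → l ≤ n → segW (a + l) (n ∸ l) < segW a l → ¬ Light a l
  heavy-Q₁ {a} {l} l≤n Q₂<Q₁ light =
    <⇒≱ (+-monoʳ-< (segW a l) Q₂<Q₁) (≤-trans light (≤-reflexive (sym (segW-complement a l≤n))))

  record Invariant (a l b : ℕ) : Set where
    field
      ends-within-Q₁ : ∀ {j m} → Light j m → j < a → j + m ≤ a + l
      bounded        : ∀ {j m} → Light j m → j + m ≤ a + l → segW j m ≤ b ⊎ (a ≤ j × j + m ≡ a + l)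
  open Invariant

  invariant-init : Invariant 0 0 0
  invariant-init = record { ends-within-Q₁ = λ _ () ; bounded = λ _ end≤ → inj₂ (z≤n , n≤0⇒n≡0 end≤) }

  invariant-grow : ∀ {a l b} → ¬ (segW (a + l) (n ∸ l) < segW a l) → Invariant a l b →
    Invariant a (suc l) (b ⊔ cutBalance a l)
  invariant-grow {a} {l} {b} Q₂≮Q₁ inv = record { ends-within-Q₁ = ends ; bounded = bnd }
    where
    Q₁≤b′ : segW a l ≤ b ⊔ cutBalance a l
    Q₁≤b′ = ≤-trans (≤-reflexive (sym (m≤n⇒m⊓n≡m (≮⇒≥ Q₂≮Q₁)))) (m≤n⊔m b _)
    ends : ∀ {j m} → Light j m → j < a → j + m ≤ a + suc l
    ends {j} {m} light j<a = ≤-trans (ends-within-Q₁ inv {j} {m} light j<a) (+-monoʳ-≤ a (n≤1+n l))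
    bnd : ∀ {j m} → Light j m → j + m ≤ a + suc l → segW j m ≤ b ⊔ cutBalance a l ⊎ (a ≤ j × j + m ≡ a + suc l)
    bnd {j} {m} light end≤ with m≤n⇒m<n∨m≡n end≤
    ... | inj₂ end≡ = inj₂ (≮⇒≥ (λ j<a → <⇒≱ (+-monoʳ-< a (n<1+n l))
                              (≤-trans (≤-reflexive (sym end≡)) (ends-within-Q₁ inv {j} {m} light j<a))) , end≡)
    ... | inj₁ end< with bounded inv {j} {m} light (s≤s⁻¹ (subst (j + m <_) (+-suc a l) end<))
    ...   | inj₁ ≤b            = inj₁ (≤-trans ≤b (m≤m⊔n b _))
    ...   | inj₂ (a≤j , end≡)  = inj₁ (≤-trans (segW-mono a≤j (≤-reflexive end≡)) Q₁≤b′)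

  invariant-shrink : ∀ {a l b} → suc l ≤ n → segW (a + suc l) (n ∸ suc l) < segW a (suc l) →
    Invariant a (suc l) b → Invariant (suc a) l (b ⊔ cutBalance a (suc l))
  invariant-shrink {a} {l} {b} l<n Q₂<Q₁ inv = record { ends-within-Q₁ = ends ; bounded = bnd }
    where
    contains-Q₁ : ∀ {j m} → Light j m → j ≤ a → a + suc l ≤ j + m → ⊥
    contains-Q₁ {j} {m} light j≤a end≤ = heavy-Q₁ l<n Q₂<Q₁ (light-⊆ {j} {m} light j≤a end≤)
    ends : ∀ {j m} → Light j m → j < suc a → j + m ≤ suc a + l
    ends {j} {m} light j<1+a with m≤n⇒m<n∨m≡n (s≤s⁻¹ j<1+a)
    ... | inj₁ j<a  = ≤-trans (ends-within-Q₁ inv {j} {m} light j<a) (≤-reflexive (+-suc a l))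
    ... | inj₂ refl = ≮⇒≥ (λ past → contains-Q₁ {j} {m} light ≤-refl (≤-trans (≤-reflexive (+-suc j l)) (<⇒≤ past)))
    bnd : ∀ {j m} → Light j m → j + m ≤ suc a + l → segW j m ≤ b ⊔ cutBalance a (suc l) ⊎ (suc a ≤ j × j + m ≡ suc a + l)
    bnd {j} {m} light end≤ with bounded inv {j} {m} light (≤-trans end≤ (≤-reflexive (sym (+-suc a l))))
    ... | inj₁ ≤b = inj₁ (≤-trans ≤b (m≤m⊔n b _))
    ... | inj₂ (a≤j , end≡) with m≤n⇒m<n∨m≡n a≤j
    ...   | inj₁ a<j  = inj₂ (a<j , trans end≡ (+-suc a l))
    ...   | inj₂ refl = ⊥-elim (contains-Q₁ {j} {m} light ≤-refl (≤-reflexive (sym end≡)))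

  IsCutBalance : ℕ → Set
  IsCutBalance b = ∃[ j ] ∃[ ℓ ] (1 ≤ ℓ × ℓ < n × balance w j ℓ ≡ b)

  BoundsCutBalances : ℕ → Set
  BoundsCutBalances b = ∀ (j : Fin n) (ℓ : ℕ) → 1 ≤ ℓ → ℓ < n → balance w j ℓ ≤ b

  Attained : ℕ → Set
  Attained b = b ≡ 0 ⊎ IsCutBalance b

  segW-pos : ∀ x {m} → 0 < m → 0 < segW x m
  segW-pos x {suc m} _ = ≤-trans (w-pos (vertex x)) (m≤m+n _ _)

  cutBalance-full : ∀ x → cutBalance x n ≡ 0
  cutBalance-full x = trans (cong (λ k → segW x n ⊓ segW (x + n) k) (n∸n≡0 n)) (⊓-zeroʳ (segW x n))

  attained-⊔ : ∀ {a l b} → l ≤ n → Attained b → Attained (b ⊔ cutBalance a l)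
  attained-⊔ {a} {l} {b} l≤n att with cutBalance a l ≤? b
  ... | yes c≤b = subst Attained (sym (m≥n⇒m⊔n≡m c≤b)) att
  ... | no  c≰b = inj₂ (vertex a , l , 1≤l , l<n , trans (balance-vertex a l≤n) (sym (m≤n⇒m⊔n≡n (<⇒≤ b<c))))
    where
    b<c : b < cutBalance a l
    b<c = ≰⇒> c≰b
    nonempty : ∀ {k} → b < cutBalance a k → 1 ≤ k
    nonempty {zero}  b<0 = ⊥-elim (n≮0 b<0)
    nonempty {suc _} _   = s≤s z≤n
    1≤l : 1 ≤ l
    1≤l = nonempty b<c
    l<n : l < n
    l<n = ≤∧≢⇒< l≤n (λ { refl → n≮0 (subst (b <_) (cutBalance-full a) b<c) })

  bounds-final : ∀ {l b} → Invariant n l b → BoundsCutBalances b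
  bounds-final {l} {b} inv j ℓ _ ℓ<n = subst (_≤ b) (sym (balance-toℕ j (<⇒≤ ℓ<n))) (min-light (≤-total s c))
    where
    x s c : ℕ
    x = toℕ j
    s = segW x ℓ
    c = segW (x + ℓ) (n ∸ ℓ)
    s+c≡W : s + c ≡ W
    s+c≡W = segW-complement x (<⇒≤ ℓ<n)
    light-bounded : ∀ y m → y < n → Light y m → segW y m ≤ b
    light-bounded y m y<n light with bounded inv {y} {m} light (ends-within-Q₁ inv {y} {m} light y<n)
    ... | inj₁ ≤b       = ≤b
    ... | inj₂ (n≤y , _) = ⊥-elim (<⇒≱ y<n n≤y)
    min-light : s ≤ c ⊎ c ≤ s → s ⊓ c ≤ b
    min-light (inj₁ s≤c) = subst (_≤ b) (sym (m≤n⇒m⊓n≡m s≤c))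
      (light-bounded x ℓ (toℕ<n j) (≤-trans (+-monoʳ-≤ s s≤c) (≤-reflexive s+c≡W)))
    min-light (inj₂ c≤s) = subst (_≤ b) (sym (trans (m≥n⇒m⊓n≡n c≤s) (sym (segW-% (x + ℓ) (n ∸ ℓ)))))
      (light-bounded ((x + ℓ) % n) (n ∸ ℓ) (m%n<n (x + ℓ) n)
        (subst (λ v → v + v ≤ W) (sym (segW-% (x + ℓ) (n ∸ ℓ))) (≤-trans (+-monoˡ-≤ c c≤s) (≤-reflexive s+c≡W))))

  attained-final : 1 < n → ∀ {b} → Attained b → BoundsCutBalances b → IsCutBalance b
  attained-final _   (inj₂ cut)  _      = cut
  attained-final 1<n (inj₁ refl) bounds = ⊥-elim (n≮0 (≤-trans 0<balance (bounds (vertex 0) 1 (s≤s z≤n) 1<n)))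
    where
    0<balance : 0 < balance w (vertex 0) 1
    0<balance = subst (0 <_) (sym (balance-vertex 0 (<⇒≤ 1<n)))
                  (⊓-glb (segW-pos 0 {1} (s≤s z≤n)) (segW-pos 1 {n ∸ 1} (m<n⇒0<n∸m 1<n)))

  record Sound (a l b : ℕ) : Set where
    field
      a≤n       : a ≤ n
      l≤n       : l ≤ n
      invariant : Invariant a l b
      attained  : Attained b
  open Sound

  sound-init : Sound 0 0 0
  sound-init = record { a≤n = z≤n ; l≤n = z≤n ; invariant = invariant-init ; attained = inj₁ refl }

  potential : ℕ → ℕ → ℕ
  potential a l = a + a + l

  Running : ℕ → ℕ → Set
  Running a l = a < n ⊎ l ≡ 0

  running-or-halted : ∀ {a l} → a ≤ n → Running a l ⊎ (a ≡ n × 1 ≤ l)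
  running-or-halted {a} {zero}  _   = inj₁ (inj₂ refl)
  running-or-halted {a} {suc l} a≤n with m≤n⇒m<n∨m≡n a≤n
  ... | inj₁ a<n = inj₁ (inj₁ a<n)
  ... | inj₂ a≡n = inj₂ (a≡n , s≤s z≤n)

  potential-running : ∀ {a l b} → Running a l → Sound a l b → potential a l < potential n n
  potential-running (inj₁ a<n) s = +-mono-<-≤ (+-mono-< a<n a<n) (l≤n s)
  potential-running (inj₂ refl) s = +-mono-≤-< (+-mono-≤ (a≤n s) (a≤n s)) (>-nonZero⁻¹ n)

  stop-running : ∀ {a l b} → Running a l → stop (state a l b) ≡ false
  stop-running {l = zero}          _          = refl
  stop-running {zero}    {suc l}   _          = refl
  stop-running {suc a}   {suc l}   (inj₁ a<n) = cong (_≡ᵇ 0) (toℕ-vertex-< a<n)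

  c₀-dequeued-nonZero : ∀ m .{{_ : NonZero m}} → c₀-dequeued m ≡ true
  c₀-dequeued-nonZero (suc _) = refl

  stop-halted : ∀ {l b} → 1 ≤ l → stop (state n l b) ≡ true
  stop-halted {suc l} _ = cong₂ _∧_ (c₀-dequeued-nonZero n) (cong (_≡ᵇ 0) (trans (toℕ-vertex n) (n%n≡0 n)))

  run-stop : ∀ {f s} → stop s ≡ true → run w (suc f) s ≡ just (bopt s)
  run-stop stopped rewrite stopped = refl

  run-continue : ∀ {f s} → stop s ≡ false → run w (suc f) s ≡ run w f (step w s)
  run-continue running rewrite running = refl

  Advance : ℕ → ℕ → ℕ → Set
  Advance a l b = ∃[ a′ ] ∃[ l′ ] ∃[ b′ ]
    (step w (state a l b) ≡ state a′ l′ b′ × Sound a′ l′ b′ × potential a′ l′ ≡ suc (potential a l))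

  W-pos : 0 < W
  W-pos = subst (0 <_) (segW-full 0) (segW-pos 0 (>-nonZero⁻¹ n))

  advance : ∀ {a l b} → Running a l → Sound a l b → Advance a l b
  advance {a} {l} {b} r s with segW (a + l) (n ∸ l) <? segW a l
  advance {a} {zero}  r          s | yes Q₂<0 = ⊥-elim (n≮0 Q₂<0)
  advance {a} {suc l} (inj₂ ())  s | yes _
  advance {a} {suc l} {b} (inj₁ a<n) s | yes Q₂<Q₁ =
    suc a , l , b ⊔ cutBalance a (suc l) , move₁ (l≤n s) Q₂<Q₁ ,
    record { a≤n = a<n ; l≤n = ≤-trans (n≤1+n l) (l≤n s)
           ; invariant = invariant-shrink (l≤n s) Q₂<Q₁ (invariant s) ; attained = attained-⊔ (l≤n s) (attained s) } ,
    cong suc (trans (cong (_+ l) (+-suc a a)) (sym (+-suc (a + a) l)))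
  ... | no Q₂≮Q₁ =
    a , suc l , b ⊔ cutBalance a l , move₂ l<n Q₂≮Q₁ ,
    record { a≤n = a≤n s ; l≤n = l<n ; invariant = invariant-grow Q₂≮Q₁ (invariant s) ; attained = attained-⊔ (l≤n s) (attained s) } ,
    +-suc (a + a) l
    where
    l<n : l < n
    l<n = ≤∧≢⇒< (l≤n s) (λ { refl → Q₂≮Q₁ (subst₂ _<_ (sym (cong (segW (a + n)) (n∸n≡0 n))) (sym (segW-full a)) W-pos) })

  Optimal : ℕ → Set
  Optimal b = BoundsCutBalances b × IsCutBalance b

  drive : 1 < n → ∀ f {a l b} → Sound a l b → potential n n ≤ f + potential a l →
    Σ ℕ (λ b* → run w (suc f) (state a l b) ≡ just b* × Optimal b*)
  drive 1<n f {a} {l} {b} s enough with running-or-halted {l = l} (a≤n s)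
  ... | inj₂ (refl , 1≤l) = b , run-stop {f} {state a l b} (stop-halted {l} {b} 1≤l) , bounds , attained-final 1<n (attained s) bounds
    where
    bounds : BoundsCutBalances b
    bounds = bounds-final (invariant s)
  drive 1<n zero    s enough | inj₁ r = ⊥-elim (<⇒≱ (potential-running r s) enough)
  drive 1<n (suc f) {a} {l} {b} s enough | inj₁ r with advance r s
  ... | a′ , l′ , b′ , stepped , s′ , gained =
    let b* , ran , optimal = drive 1<n f s′ (≤-trans enough (≤-reflexive (trans (sym (+-suc f _)) (cong (f +_) (sym gained)))))
    in b* , trans (run-continue {suc f} {state a l b} (stop-running {a} {l} {b} r)) (trans (cong (run w (suc f)) stepped) ran) , optimal

  scan-optimal : 1 < n → Σ ℕ (λ b → (∃[ fuel ] run w fuel (init n) ≡ just b) × Optimal b)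
  scan-optimal 1<n =
    let b , ran , optimal = drive 1<n (potential n n) sound-init (≤-reflexive (sym (+-identityʳ _)))
    in b , (suc (potential n n) , trans (cong (run w (suc (potential n n))) init≡state) ran) , optimal

lemma5 : (i : ℕ) → 2 ≤ i → (w : Fin i → ℕ) → (∀ j → 0 < w j) →
    Σ ℕ (λ b →
      (∃[ fuel ] run w fuel (init i) ≡ just b)
      × (∀ (j : Fin i) (ℓ : ℕ) → 1 ≤ ℓ → ℓ < i → balance w j ℓ ≤ b)
      × (∃[ j ] ∃[ ℓ ] (1 ≤ ℓ × ℓ < i × balance w j ℓ ≡ b)))
lemma5 i 1<i w w-pos = Scan.scan-optimal i {{>-nonZero (<-trans z<s 1<i)}} w w-pos 1<i
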